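{- Let $M$ be a matroid on $A$ and $N$ a matroid on $B$ with $A\cap B=\emptyset$ and $|A|,|B|\geq 2$, and let $L=M\oplus N$. Then $L$ is irreducible if and only if $M$ and $N$ are irreducible.
   Context: For a matroid $K$ on $E$ and $C,D\subseteq E$ with $C\cup D=E$, $(C,D)$ is a free separator of $K$ if $K=K|C\mathbin{\Join} K.D$, where $K.D=K/(E-D)$ and, for matched $M(A)$, $N(B)$ (i.e. $M.(A\cap B)=N|(A\cap B)$), the free splice $M\mathbin{\Join} N$ is the matroid on $A\cup B$ with rank $r(X)=\min\{r_M(X\cap A)+|X-A|,\ r_N(X\cap B)+r_M(A-B)\}$. $K$ is reducible if it has a free separator $(C,D)$ with $C-D$ and $D-C$ both nonempty, and irreducible otherwise. -}

module Defs where

open import Data.Nat using (ℕ; _+_; _∸_; _≤_; _⊓_)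
open import Data.Fin.Subset using (Subset; _⊆_; _∩_; _∪_; _─_; ∣_∣; Nonempty)
open import Data.Product using (Σ; _×_; ∃)
open import Relation.Binary.PropositionalEquality using (_≡_)
open import Relation.Nullary using (¬_)

-- A (finite) matroid on a ground set E ⊆ Fin n, given by its rank function.
-- Only the values of the rank function on subsets of E are meaningful.
record IsMatroid {n : ℕ} (E : Subset n) (r : Subset n → ℕ) : Set where
  field
    rank-bound : ∀ X → X ⊆ E → r X ≤ ∣ X ∣
    rank-mono  : ∀ X Y → Y ⊆ E → X ⊆ Y → r X ≤ r Y
    rank-submod : ∀ X Y → X ⊆ E → Y ⊆ E → r (X ∪ Y) + r (X ∩ Y) ≤ r X + r Y

restrictRank : ∀ {n} → (Subset n → ℕ) → Subset n → Subset n → ℕ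
restrictRank r C X = r (X ∩ C)

-- Rank function of K.D = K/(E−D), for K on E.
contractToRank : ∀ {n} → Subset n → (Subset n → ℕ) → Subset n → Subset n → ℕ
contractToRank E r D X = r ((X ∩ D) ∪ (E ─ D)) ∸ r (E ─ D)

spliceRank : ∀ {n} → Subset n → (Subset n → ℕ) → Subset n → (Subset n → ℕ) → Subset n → ℕ
spliceRank A rM B rN X = (rM (X ∩ A) + ∣ X ─ A ∣) ⊓ (rN (X ∩ B) + rM (A ─ B))

-- (C,D) is a free separator of K (on E, rank r): C ∪ D = E and K = K|C ⋈ K.D.
-- (K|C and K.D are always matched.)
IsFreeSeparator : ∀ {n} → Subset n → (Subset n → ℕ) → Subset n → Subset n → Set
IsFreeSeparator E r C D =
  (C ∪ D ≡ E) ×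
  (∀ X → X ⊆ E → r X ≡ spliceRank C (restrictRank r C) D (contractToRank E r D) X)

Reducible : ∀ {n} → Subset n → (Subset n → ℕ) → Set
Reducible {n} E r = Σ (Subset n) λ C → Σ (Subset n) λ D →
  IsFreeSeparator E r C D × Nonempty (C ─ D) × Nonempty (D ─ C)

Irreducible : ∀ {n} → Subset n → (Subset n → ℕ) → Set
Irreducible E r = ¬ Reducible E r

directSumRank : ∀ {n} → Subset n → (Subset n → ℕ) → Subset n → (Subset n → ℕ) → Subset n → ℕ
directSumRank A rM B rN X = rM (X ∩ A) + rN (X ∩ B)

-- For a matroid K the rank of K|C ⋈ K.D at X is the minimum of two upper
-- bounds on r X, so (C , D) is a free separator iff at every X one of the two
-- bounds is attained.  A free separator of M stays one for M ⊕ N after adding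
-- B to both sides, so reducibility of M or N passes to M ⊕ N.  Conversely a
-- free separator (C , D) of M ⊕ N whose witnesses in C − D and D − C lie on the
-- same side restricts to a free separator of that side.  If they lie on
-- different sides, the split is tight at X = A, which produces a coloop of M or
-- a loop of N; with at least two elements, a loop e yields the free separator
-- ({e} , E − e) and a coloop e the free separator (E − e , {e}).

module Submission where

open import Defs
open import Data.Nat using (ℕ; _≤_)
open import Data.Fin.Subset using (Subset; _∩_; _∪_; ⊥; ∣_∣)
open import Data.Product using (_×_)
open import Relation.Binary.PropositionalEquality using (_≡_)
open import Function.Bundles using (_⇔_)

open import Data.Bool using (Bool; true; false; T; _∧_; _∨_; not)
open import Data.Bool.Properties using (T-∧)
import Data.Bool.Properties as Bool
open import Data.Fin using (Fin; zero; suc)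
open import Data.Fin.Subset using (_─_; ⁅_⁆; _∈_; _∉_; _⊆_; Nonempty)
open import Data.Fin.Subset.Properties
open import Data.List using (List; []; _∷_)
open import Data.List.Relation.Unary.All as All using (All; []; _∷_)
open import Data.Nat using (zero; suc; _+_; _∸_; _<_; _⊓_; s≤s)
open import Data.Nat.Properties
open import Algebra.Properties.CommutativeSemigroup +-commutativeSemigroup using (interchange; xy∙z≈xz∙y)
open import Data.Product using (_,_; proj₁; proj₂)
open import Data.Sum using (_⊎_; inj₁; inj₂; [_,_]; swap)
open import Data.Vec using (Vec; []; _∷_; lookup; map; head; tail)
open import Data.Vec.Properties using (lookup-map; ∷-injective)
open import Function using (_∘_)
open import Function.Bundles using (Equivalence; mk⇔)
open import Relation.Binary.PropositionalEquality using (refl; sym; trans; cong; cong₂; subst; subst₂; module ≡-Reasoning)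
open import Relation.Nullary using (Dec; yes; no; contradiction)
open import Relation.Nullary.Decidable using (isYes; toWitness; fromWitness)

module SubsetSolver where

  infixr 9 _∩ₑ_
  infixr 8 _∪ₑ_
  infixl 7 _─ₑ_
  infix 6 _≐_

  data SetExpr (k : ℕ) : Set where
    var            : Fin k → SetExpr k
    ∅              : SetExpr k
    _∩ₑ_ _∪ₑ_ _─ₑ_ : SetExpr k → SetExpr k → SetExpr k

  record Equation (k : ℕ) : Set where
    constructor _≐_
    field lhs rhs : SetExpr k

  pattern v₀ = var zero
  pattern v₁ = var (suc zero)
  pattern v₂ = var (suc (suc zero))
  pattern v₃ = var (suc (suc (suc zero)))
  pattern v₄ = var (suc (suc (suc (suc zero))))
  pattern v₅ = var (suc (suc (suc (suc (suc zero)))))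

  module _ {k : ℕ} where

    infix 4 _⊨_ _⊨ᵇ_

    ⟦_⟧ : ∀ {n} → SetExpr k → Vec (Subset n) k → Subset n
    ⟦ var i  ⟧ ρ = lookup ρ i
    ⟦ ∅      ⟧ ρ = ⊥
    ⟦ e ∩ₑ f ⟧ ρ = ⟦ e ⟧ ρ ∩ ⟦ f ⟧ ρ
    ⟦ e ∪ₑ f ⟧ ρ = ⟦ e ⟧ ρ ∪ ⟦ f ⟧ ρ
    ⟦ e ─ₑ f ⟧ ρ = ⟦ e ⟧ ρ ─ ⟦ f ⟧ ρ

    ⟦_⟧ᵇ : SetExpr k → Vec Bool k → Bool
    ⟦ var i  ⟧ᵇ β = lookup β i
    ⟦ ∅      ⟧ᵇ β = false
    ⟦ e ∩ₑ f ⟧ᵇ β = ⟦ e ⟧ᵇ β ∧ ⟦ f ⟧ᵇ β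
    ⟦ e ∪ₑ f ⟧ᵇ β = ⟦ e ⟧ᵇ β ∨ ⟦ f ⟧ᵇ β
    ⟦ e ─ₑ f ⟧ᵇ β = ⟦ e ⟧ᵇ β ∧ not (⟦ f ⟧ᵇ β)

    _⊨_ : ∀ {n} → Vec (Subset n) k → Equation k → Set
    ρ ⊨ l ≐ r = ⟦ l ⟧ ρ ≡ ⟦ r ⟧ ρ

    _⊨ᵇ_ : Vec Bool k → Equation k → Set
    β ⊨ᵇ l ≐ r = ⟦ l ⟧ᵇ β ≡ ⟦ r ⟧ᵇ β

    _⊨ᵇ?_ : ∀ β eq → Dec (β ⊨ᵇ eq)
    β ⊨ᵇ? (l ≐ r) = ⟦ l ⟧ᵇ β Bool.≟ ⟦ r ⟧ᵇ β

    holdsᵇ : Vec Bool k → Equation k → Bool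
    holdsᵇ β eq = isYes (β ⊨ᵇ? eq)

    entailsᵇ : List (Equation k) → Equation k → Vec Bool k → Bool
    entailsᵇ []       goal β = holdsᵇ β goal
    entailsᵇ (h ∷ hs) goal β = not (holdsᵇ β h) ∨ entailsᵇ hs goal β

    entailsᵇ-sound : ∀ hs goal β → T (entailsᵇ hs goal β) → All (β ⊨ᵇ_) hs → β ⊨ᵇ goal
    entailsᵇ-sound []       goal β t [] = toWitness {a? = β ⊨ᵇ? goal} t
    entailsᵇ-sound (h ∷ hs) goal β t (βh ∷ βhs) =
      entailsᵇ-sound hs goal β (modusPonens t (fromWitness {a? = β ⊨ᵇ? h} βh)) βhs
      where
      modusPonens : ∀ {x y} → T (not x ∨ y) → T x → T y
      modusPonens {true} t _ = t

  everyAssignment : ∀ k → (Vec Bool k → Bool) → Bool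
  everyAssignment zero    P = P []
  everyAssignment (suc k) P = everyAssignment k (λ β → P (false ∷ β)) ∧ everyAssignment k (λ β → P (true ∷ β))

  everyAssignment-sound : ∀ k P → T (everyAssignment k P) → ∀ β → T (P β)
  everyAssignment-sound zero    P t [] = t
  everyAssignment-sound (suc k) P t (false ∷ β) = everyAssignment-sound k _ (proj₁ (Equivalence.to T-∧ t)) β
  everyAssignment-sound (suc k) P t (true  ∷ β) = everyAssignment-sound k _ (proj₂ (Equivalence.to T-∧ t)) β

  module _ {k n : ℕ} where

    ⟦⟧-∷ : ∀ (e : SetExpr k) (ρ : Vec (Subset (suc n)) k) → ⟦ e ⟧ ρ ≡ ⟦ e ⟧ᵇ (map head ρ) ∷ ⟦ e ⟧ (map tail ρ)
    ⟦⟧-∷ (var i)  ρ = trans (head∷tail (lookup ρ i)) (sym (cong₂ _∷_ (lookup-map i head ρ) (lookup-map i tail ρ)))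
      where
      head∷tail : (xs : Subset (suc n)) → xs ≡ head xs ∷ tail xs
      head∷tail (x ∷ xs) = refl
    ⟦⟧-∷ ∅        ρ = refl
    ⟦⟧-∷ (e ∩ₑ f) ρ = cong₂ _∩_ (⟦⟧-∷ e ρ) (⟦⟧-∷ f ρ)
    ⟦⟧-∷ (e ∪ₑ f) ρ = cong₂ _∪_ (⟦⟧-∷ e ρ) (⟦⟧-∷ f ρ)
    ⟦⟧-∷ (e ─ₑ f) ρ = trans (cong₂ _─_ (⟦⟧-∷ e ρ) (⟦⟧-∷ f ρ)) (─-∷ (⟦ e ⟧ᵇ _) (⟦ f ⟧ᵇ _))
      where
      ─-∷ : ∀ x y {xs ys : Subset n} → (x ∷ xs) ─ (y ∷ ys) ≡ (x ∧ not y) ∷ (xs ─ ys)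
      ─-∷ false false = refl
      ─-∷ false true  = refl
      ─-∷ true  false = refl
      ─-∷ true  true  = refl

    ⊨-∷ : ∀ {ρ : Vec (Subset (suc n)) k} eq → ρ ⊨ eq → map head ρ ⊨ᵇ eq × map tail ρ ⊨ eq
    ⊨-∷ {ρ} (l ≐ r) h = ∷-injective (trans (sym (⟦⟧-∷ l ρ)) (trans h (⟦⟧-∷ r ρ)))

  -- Subset operations act coordinatewise, so an identity that follows from the
  -- hypotheses bit by bit holds for subsets of every size.
  solve : ∀ {k} (hs : List (Equation k)) (goal : Equation k) → T (everyAssignment k (entailsᵇ hs goal)) →
          ∀ {n} (ρ : Vec (Subset n) k) → All (ρ ⊨_) hs → ρ ⊨ goal
  solve hs (l ≐ r) valid {zero} ρ _ = vec₀-unique (⟦ l ⟧ ρ) (⟦ r ⟧ ρ)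
    where
    vec₀-unique : (xs ys : Subset 0) → xs ≡ ys
    vec₀-unique [] [] = refl
  solve {k} hs goal@(l ≐ r) valid {suc n} ρ hyps = begin
    ⟦ l ⟧ ρ                                   ≡⟨ ⟦⟧-∷ l ρ ⟩
    ⟦ l ⟧ᵇ (map head ρ) ∷ ⟦ l ⟧ (map tail ρ)  ≡⟨ cong₂ _∷_ headsAgree tailsAgree ⟩
    ⟦ r ⟧ᵇ (map head ρ) ∷ ⟦ r ⟧ (map tail ρ)  ≡⟨ ⟦⟧-∷ r ρ ⟨
    ⟦ r ⟧ ρ                                   ∎
    where
    open ≡-Reasoning
    headsAgree : map head ρ ⊨ᵇ goal
    headsAgree = entailsᵇ-sound hs goal (map head ρ)
      (everyAssignment-sound k (entailsᵇ hs goal) valid (map head ρ)) (All.map (λ {eq} h → proj₁ (⊨-∷ eq h)) hyps)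
    tailsAgree : map tail ρ ⊨ goal
    tailsAgree = solve hs goal valid (map tail ρ) (All.map (λ {eq} h → proj₂ (⊨-∷ eq h)) hyps)

open SubsetSolver

open ≤-Reasoning

∣p∣≡∣p∩q∣+∣p─q∣ : ∀ {n} (p q : Subset n) → ∣ p ∣ ≡ ∣ p ∩ q ∣ + ∣ p ─ q ∣
∣p∣≡∣p∩q∣+∣p─q∣ []          []          = refl
∣p∣≡∣p∩q∣+∣p─q∣ (true  ∷ p) (true  ∷ q) = cong suc (∣p∣≡∣p∩q∣+∣p─q∣ p q)
∣p∣≡∣p∩q∣+∣p─q∣ (true  ∷ p) (false ∷ q) = trans (cong suc (∣p∣≡∣p∩q∣+∣p─q∣ p q)) (sym (+-suc _ _))
∣p∣≡∣p∩q∣+∣p─q∣ (false ∷ p) (true  ∷ q) = ∣p∣≡∣p∩q∣+∣p─q∣ p q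
∣p∣≡∣p∩q∣+∣p─q∣ (false ∷ p) (false ∷ q) = ∣p∣≡∣p∩q∣+∣p─q∣ p q

module _ {n : ℕ} where

  ⊆⇒∩≡ : {p q : Subset n} → p ⊆ q → p ∩ q ≡ p
  ⊆⇒∩≡ {p} {q} p⊆q = ⊆-antisym (p∩q⊆p p q) (λ x∈p → x∈p∩q⁺ (x∈p , p⊆q x∈p))

  ∩≡⇒⊆ : {p q : Subset n} → p ∩ q ≡ p → p ⊆ q
  ∩≡⇒⊆ {p} {q} p∩q≡p {x} x∈p = p∩q⊆q p q (subst (x ∈_) (sym p∩q≡p) x∈p)

  ∪-lub : {p q s : Subset n} → p ⊆ s → q ⊆ s → p ∪ q ⊆ s
  ∪-lub {p} {q} p⊆s q⊆s x∈p∪q = [ p⊆s , q⊆s ] (x∈p∪q⁻ p q x∈p∪q)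

  ∈⇒⁅⁆⊆ : {x : Fin n} {p : Subset n} → x ∈ p → ⁅ x ⁆ ⊆ p
  ∈⇒⁅⁆⊆ {x} {p} x∈p {y} y∈⁅x⁆ = subst (_∈ p) (sym (x∈⁅y⁆⇒x≡y x y∈⁅x⁆)) x∈p

  ∉⇒⁅⁆∩≡⊥ : {x : Fin n} {p : Subset n} → x ∉ p → ⁅ x ⁆ ∩ p ≡ ⊥
  ∉⇒⁅⁆∩≡⊥ {x} {p} x∉p = Empty-unique λ (y , y∈⁅x⁆∩p) →
    let (y∈⁅x⁆ , y∈p) = x∈p∩q⁻ ⁅ x ⁆ p y∈⁅x⁆∩p in x∉p (subst (_∈ p) (x∈⁅y⁆⇒x≡y x y∈⁅x⁆) y∈p)

  x∈p─q⇒x∉q : {x : Fin n} {p q : Subset n} → x ∈ p ─ q → x ∉ q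
  x∈p─q⇒x∉q {x} {p} {q} x∈p─q x∈q =
    ∉⊥ (subst (x ∈_) (solve [] ((v₀ ─ₑ v₁) ∩ₑ v₁ ≐ ∅) _ (p ∷ q ∷ []) []) (x∈p∩q⁺ (x∈p─q , x∈q)))

  x∈p─q⇒x∈p∩s─q∩s : {x : Fin n} {p q s : Subset n} → x ∈ p ─ q → x ∈ s → x ∈ (p ∩ s) ─ (q ∩ s)
  x∈p─q⇒x∈p∩s─q∩s {x} {p} {q} {s} x∈p─q x∈s = x∈p∧x∉q⇒x∈p─q (x∈p∩q⁺ (p─q⊆p p q x∈p─q , x∈s))
    (λ x∈q∩s → x∈p─q⇒x∉q x∈p─q (proj₁ (x∈p∩q⁻ q s x∈q∩s)))

  x∈⁅x⁆─[p─⁅x⁆] : (x : Fin n) (p : Subset n) → x ∈ ⁅ x ⁆ ─ (p ─ ⁅ x ⁆)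
  x∈⁅x⁆─[p─⁅x⁆] x p = subst (x ∈_) (sym (solve [] (v₀ ─ₑ (v₁ ─ₑ v₀) ≐ v₀) _ (⁅ x ⁆ ∷ p ∷ []) [])) (x∈⁅x⁆ x)

  x∈p⇒∣p∣≡1+∣p─⁅x⁆∣ : {x : Fin n} {p : Subset n} → x ∈ p → ∣ p ∣ ≡ suc ∣ p ─ ⁅ x ⁆ ∣
  x∈p⇒∣p∣≡1+∣p─⁅x⁆∣ {x} {p} x∈p = trans (∣p∣≡∣p∩q∣+∣p─q∣ p ⁅ x ⁆)
    (cong (_+ ∣ p ─ ⁅ x ⁆ ∣) (trans (cong ∣_∣ (trans (∩-comm p ⁅ x ⁆) (⊆⇒∩≡ (∈⇒⁅⁆⊆ x∈p)))) (∣⁅x⁆∣≡1 x)))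

  2≤∣p∣⇒nonempty-p─⁅x⁆ : {x : Fin n} {p : Subset n} → 2 ≤ ∣ p ∣ → Nonempty (p ─ ⁅ x ⁆)
  2≤∣p∣⇒nonempty-p─⁅x⁆ {x} {p} 2≤∣p∣ with nonempty? (p ─ ⁅ x ⁆)
  ... | yes nonempty = nonempty
  ... | no  empty    = contradiction (≤-trans 2≤∣p∣ ∣p∣≤1) λ { (s≤s ()) }
    where
    ∣p∣≤1 : ∣ p ∣ ≤ 1
    ∣p∣≤1 = begin
      ∣ p ∣                             ≡⟨ ∣p∣≡∣p∩q∣+∣p─q∣ p ⁅ x ⁆ ⟩
      ∣ p ∩ ⁅ x ⁆ ∣ + ∣ p ─ ⁅ x ⁆ ∣     ≡⟨ cong (λ s → ∣ p ∩ ⁅ x ⁆ ∣ + ∣ s ∣) (Empty-unique empty) ⟩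
      ∣ p ∩ ⁅ x ⁆ ∣ + ∣ ⊥ {n = n} ∣     ≡⟨ cong (∣ p ∩ ⁅ x ⁆ ∣ +_) (∣⊥∣≡0 n) ⟩
      ∣ p ∩ ⁅ x ⁆ ∣ + 0                 ≡⟨ +-identityʳ _ ⟩
      ∣ p ∩ ⁅ x ⁆ ∣                     ≤⟨ ∣p∩q∣≤∣q∣ p ⁅ x ⁆ ⟩
      ∣ ⁅ x ⁆ ∣                         ≡⟨ ∣⁅x⁆∣≡1 x ⟩
      1                                 ∎

≡⊓⇒attained : ∀ {x a b} → x ≡ a ⊓ b → a ≤ x ⊎ b ≤ x
≡⊓⇒attained {a = a} {b} refl with ⊓-sel a b
... | inj₁ a⊓b≡a = inj₁ (≤-reflexive (sym a⊓b≡a))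
... | inj₂ a⊓b≡b = inj₂ (≤-reflexive (sym a⊓b≡b))

attained⇒≡⊓ : ∀ {x a b} → x ≤ a → x ≤ b → a ≤ x ⊎ b ≤ x → x ≡ a ⊓ b
attained⇒≡⊓ {a = a} {b} x≤a x≤b attained = ≤-antisym (⊓-glb x≤a x≤b)
  ([ ≤-trans (m⊓n≤m a b) , ≤-trans (m⊓n≤n a b) ] attained)

a+b≤c+d⇒d<a⇒b<c : ∀ {a b c d} → a + b ≤ c + d → d < a → b < c
a+b≤c+d⇒d<a⇒b<c {a} {b} {c} {d} a+b≤c+d d<a = +-cancelʳ-< d b c (begin-strict
  b + d  <⟨ +-monoʳ-< b d<a ⟩
  b + a  ≡⟨ +-comm b a ⟩
  a + b  ≤⟨ a+b≤c+d ⟩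
  c + d  ∎)

SpliceTight : ∀ {n} → (Subset n → ℕ) → Subset n → Subset n → Subset n → Set
SpliceTight r C D X = (r (X ∩ C) + ∣ X ─ C ∣ ≤ r X) ⊎ (r ((X ∩ D) ∪ (C ─ D)) ≤ r X)

module _ {n : ℕ} {E : Subset n} {r : Subset n → ℕ} (K : IsMatroid E r) where

  open IsMatroid K

  r⊥≡0 : r ⊥ ≡ 0
  r⊥≡0 = n≤0⇒n≡0 (subst (r ⊥ ≤_) (∣⊥∣≡0 n) (rank-bound ⊥ ⊥⊆))

  r-subadditive : ∀ {X Y} → X ⊆ E → Y ⊆ E → r (X ∪ Y) ≤ r X + r Y
  r-subadditive {X} {Y} X⊆E Y⊆E = ≤-trans (m≤m+n _ _) (rank-submod X Y X⊆E Y⊆E)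

  r[X∪Y]≤r[X]+∣Y∣ : ∀ {X Y} → X ⊆ E → Y ⊆ E → r (X ∪ Y) ≤ r X + ∣ Y ∣
  r[X∪Y]≤r[X]+∣Y∣ {X} {Y} X⊆E Y⊆E = ≤-trans (r-subadditive X⊆E Y⊆E) (+-monoʳ-≤ (r X) (rank-bound Y Y⊆E))

  r≤restrictionBound : ∀ {X} C → X ⊆ E → r X ≤ r (X ∩ C) + ∣ X ─ C ∣
  r≤restrictionBound {X} C X⊆E = subst (λ Z → r Z ≤ r (X ∩ C) + ∣ X ─ C ∣)
    (solve [] ((v₀ ∩ₑ v₁) ∪ₑ (v₀ ─ₑ v₁) ≐ v₀) _ (X ∷ C ∷ []) [])
    (r[X∪Y]≤r[X]+∣Y∣ (⊆-trans (p∩q⊆p X C) X⊆E) (⊆-trans (p─q⊆p X C) X⊆E))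

  contractionSet⊆ : ∀ {C D} X → C ∪ D ≡ E → (X ∩ D) ∪ (C ─ D) ⊆ E
  contractionSet⊆ {C} {D} X C∪D≡E =
    ∩≡⇒⊆ (solve (v₁ ∪ₑ v₂ ≐ v₃ ∷ []) (((v₀ ∩ₑ v₂) ∪ₑ (v₁ ─ₑ v₂)) ∩ₑ v₃ ≐ (v₀ ∩ₑ v₂) ∪ₑ (v₁ ─ₑ v₂)) _
                 (X ∷ C ∷ D ∷ E ∷ []) (C∪D≡E ∷ []))

  r≤contractionBound : ∀ {C D X} → C ∪ D ≡ E → X ⊆ E → r X ≤ r ((X ∩ D) ∪ (C ─ D))
  r≤contractionBound {C} {D} {X} C∪D≡E X⊆E = rank-mono X _ (contractionSet⊆ X C∪D≡E)
    (∩≡⇒⊆ (solve (v₁ ∪ₑ v₂ ≐ v₃ ∷ v₀ ∩ₑ v₃ ≐ v₀ ∷ []) (v₀ ∩ₑ ((v₀ ∩ₑ v₂) ∪ₑ (v₁ ─ₑ v₂)) ≐ v₀) _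
                  (X ∷ C ∷ D ∷ E ∷ []) (C∪D≡E ∷ ⊆⇒∩≡ X⊆E ∷ [])))

  spliceRank-restrict-contract : ∀ {C D} → C ∪ D ≡ E → ∀ X →
    spliceRank C (restrictRank r C) D (contractToRank E r D) X ≡ (r (X ∩ C) + ∣ X ─ C ∣) ⊓ r ((X ∩ D) ∪ (C ─ D))
  spliceRank-restrict-contract {C} {D} C∪D≡E X =
    cong₂ _⊓_ (cong (λ Z → r Z + ∣ X ─ C ∣) (trans (∩-assoc X C C) (cong (X ∩_) (∩-idem C)))) contracted
    where
    ρ : Vec (Subset n) 4
    ρ = X ∷ C ∷ D ∷ E ∷ []
    E─D≡C─D : E ─ D ≡ C ─ D
    E─D≡C─D = solve (v₁ ∪ₑ v₂ ≐ v₃ ∷ []) (v₃ ─ₑ v₂ ≐ v₁ ─ₑ v₂) _ ρ (C∪D≡E ∷ [])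
    contracted : r (((X ∩ D) ∩ D) ∪ (E ─ D)) ∸ r (E ─ D) + r ((C ─ D) ∩ C) ≡ r ((X ∩ D) ∪ (C ─ D))
    contracted = begin-equality
      r (((X ∩ D) ∩ D) ∪ (E ─ D)) ∸ r (E ─ D) + r ((C ─ D) ∩ C)
        ≡⟨ cong₂ (λ Y Z → r Y ∸ r Z + r ((C ─ D) ∩ C))
             (solve (v₁ ∪ₑ v₂ ≐ v₃ ∷ []) (((v₀ ∩ₑ v₂) ∩ₑ v₂) ∪ₑ (v₃ ─ₑ v₂) ≐ (v₀ ∩ₑ v₂) ∪ₑ (v₁ ─ₑ v₂)) _ ρ (C∪D≡E ∷ []))
             E─D≡C─D ⟩
      r ((X ∩ D) ∪ (C ─ D)) ∸ r (C ─ D) + r ((C ─ D) ∩ C)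
        ≡⟨ cong (λ Z → r ((X ∩ D) ∪ (C ─ D)) ∸ r (C ─ D) + r Z) (solve [] ((v₁ ─ₑ v₂) ∩ₑ v₁ ≐ v₁ ─ₑ v₂) _ ρ []) ⟩
      r ((X ∩ D) ∪ (C ─ D)) ∸ r (C ─ D) + r (C ─ D)
        ≡⟨ m∸n+n≡m (rank-mono (C ─ D) _ (contractionSet⊆ X C∪D≡E) (q⊆p∪q (X ∩ D) (C ─ D))) ⟩
      r ((X ∩ D) ∪ (C ─ D)) ∎

  freeSeparator⇒tight : ∀ {C D} → IsFreeSeparator E r C D → ∀ {X} → X ⊆ E → SpliceTight r C D X
  freeSeparator⇒tight (C∪D≡E , r≡splice) {X} X⊆E =
    ≡⊓⇒attained (trans (r≡splice X X⊆E) (spliceRank-restrict-contract C∪D≡E X))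

  tight⇒freeSeparator : ∀ {C D} → C ∪ D ≡ E → (∀ {X} → X ⊆ E → SpliceTight r C D X) → IsFreeSeparator E r C D
  tight⇒freeSeparator {C} C∪D≡E tight = C∪D≡E , λ X X⊆E →
    trans (attained⇒≡⊓ (r≤restrictionBound C X⊆E) (r≤contractionBound C∪D≡E X⊆E) (tight X⊆E))
          (sym (spliceRank-restrict-contract C∪D≡E X))

  loop⇒reducible : ∀ {e} → 2 ≤ ∣ E ∣ → e ∈ E → r ⁅ e ⁆ ≡ 0 → Reducible E r
  loop⇒reducible {e} 2≤∣E∣ e∈E loop =
    ⁅ e ⁆ , E ─ ⁅ e ⁆ ,
    tight⇒freeSeparator (solve (v₀ ∩ₑ v₁ ≐ v₀ ∷ []) (v₀ ∪ₑ (v₁ ─ₑ v₀) ≐ v₁) _ (⁅ e ⁆ ∷ E ∷ []) (⊆⇒∩≡ e⊆E ∷ [])) tight ,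
    (e , x∈⁅x⁆─[p─⁅x⁆] e E) ,
    subst Nonempty (sym (p─q─q≡p─q E ⁅ e ⁆)) (2≤∣p∣⇒nonempty-p─⁅x⁆ 2≤∣E∣)
    where
    e⊆E : ⁅ e ⁆ ⊆ E
    e⊆E = ∈⇒⁅⁆⊆ e∈E
    tight : ∀ {X} → X ⊆ E → SpliceTight r ⁅ e ⁆ (E ─ ⁅ e ⁆) X
    tight {X} X⊆E = inj₂ (begin
      r ((X ∩ (E ─ ⁅ e ⁆)) ∪ (⁅ e ⁆ ─ (E ─ ⁅ e ⁆)))
        ≤⟨ rank-mono _ (X ∪ ⁅ e ⁆) (∪-lub X⊆E e⊆E) (∩≡⇒⊆
             (solve [] (((v₀ ∩ₑ (v₂ ─ₑ v₁)) ∪ₑ (v₁ ─ₑ (v₂ ─ₑ v₁))) ∩ₑ (v₀ ∪ₑ v₁) ≐ (v₀ ∩ₑ (v₂ ─ₑ v₁)) ∪ₑ (v₁ ─ₑ (v₂ ─ₑ v₁)))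
                    _ (X ∷ ⁅ e ⁆ ∷ E ∷ []) [])) ⟩
      r (X ∪ ⁅ e ⁆)  ≤⟨ r-subadditive X⊆E e⊆E ⟩
      r X + r ⁅ e ⁆  ≡⟨ cong (r X +_) loop ⟩
      r X + 0        ≡⟨ +-identityʳ (r X) ⟩
      r X            ∎)

  coloop-restrict : ∀ {e X} → r (E ─ ⁅ e ⁆) < r E → X ⊆ E → e ∈ X → r (X ─ ⁅ e ⁆) < r X
  coloop-restrict {e} {X} coloop X⊆E e∈X = a+b≤c+d⇒d<a⇒b<c submod coloop
    where
    ρ : Vec (Subset n) 3
    ρ = X ∷ ⁅ e ⁆ ∷ E ∷ []
    hyps : All (ρ ⊨_) (v₀ ∩ₑ v₂ ≐ v₀ ∷ v₁ ∩ₑ v₀ ≐ v₁ ∷ [])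
    hyps = ⊆⇒∩≡ X⊆E ∷ ⊆⇒∩≡ (∈⇒⁅⁆⊆ e∈X) ∷ []
    submod : r E + r (X ─ ⁅ e ⁆) ≤ r X + r (E ─ ⁅ e ⁆)
    submod = subst₂ (λ U I → r U + r I ≤ r X + r (E ─ ⁅ e ⁆))
      (solve (v₀ ∩ₑ v₂ ≐ v₀ ∷ v₁ ∩ₑ v₀ ≐ v₁ ∷ []) (v₀ ∪ₑ (v₂ ─ₑ v₁) ≐ v₂) _ ρ hyps)
      (solve (v₀ ∩ₑ v₂ ≐ v₀ ∷ v₁ ∩ₑ v₀ ≐ v₁ ∷ []) (v₀ ∩ₑ (v₂ ─ₑ v₁) ≐ v₀ ─ₑ v₁) _ ρ hyps)
      (rank-submod X (E ─ ⁅ e ⁆) X⊆E (p─q⊆p E ⁅ e ⁆))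

  coloop⇒reducible : ∀ {e} → 2 ≤ ∣ E ∣ → e ∈ E → r (E ─ ⁅ e ⁆) < r E → Reducible E r
  coloop⇒reducible {e} 2≤∣E∣ e∈E coloop =
    E ─ ⁅ e ⁆ , ⁅ e ⁆ ,
    tight⇒freeSeparator (solve (v₀ ∩ₑ v₁ ≐ v₀ ∷ []) ((v₁ ─ₑ v₀) ∪ₑ v₀ ≐ v₁) _ (⁅ e ⁆ ∷ E ∷ []) (⊆⇒∩≡ (∈⇒⁅⁆⊆ e∈E) ∷ [])) tight ,
    subst Nonempty (sym (p─q─q≡p─q E ⁅ e ⁆)) (2≤∣p∣⇒nonempty-p─⁅x⁆ 2≤∣E∣) ,
    (e , x∈⁅x⁆─[p─⁅x⁆] e E)
    where
    tight : ∀ {X} → X ⊆ E → SpliceTight r (E ─ ⁅ e ⁆) ⁅ e ⁆ X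
    tight {X} X⊆E with e ∈? X
    ... | yes e∈X = inj₁ (begin
      r (X ∩ (E ─ ⁅ e ⁆)) + ∣ X ─ (E ─ ⁅ e ⁆) ∣
        ≡⟨ cong₂ (λ Y Z → r Y + ∣ Z ∣)
             (solve (v₀ ∩ₑ v₂ ≐ v₀ ∷ v₁ ∩ₑ v₀ ≐ v₁ ∷ []) (v₀ ∩ₑ (v₂ ─ₑ v₁) ≐ v₀ ─ₑ v₁) _ ρ hyps)
             (solve (v₀ ∩ₑ v₂ ≐ v₀ ∷ v₁ ∩ₑ v₀ ≐ v₁ ∷ []) (v₀ ─ₑ (v₂ ─ₑ v₁) ≐ v₁) _ ρ hyps) ⟩
      r (X ─ ⁅ e ⁆) + ∣ ⁅ e ⁆ ∣  ≡⟨ cong (r (X ─ ⁅ e ⁆) +_) (∣⁅x⁆∣≡1 e) ⟩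
      r (X ─ ⁅ e ⁆) + 1          ≡⟨ +-comm _ 1 ⟩
      suc (r (X ─ ⁅ e ⁆))        ≤⟨ coloop-restrict coloop X⊆E e∈X ⟩
      r X                        ∎)
      where
      ρ : Vec (Subset n) 3
      ρ = X ∷ ⁅ e ⁆ ∷ E ∷ []
      hyps : All (ρ ⊨_) (v₀ ∩ₑ v₂ ≐ v₀ ∷ v₁ ∩ₑ v₀ ≐ v₁ ∷ [])
      hyps = ⊆⇒∩≡ X⊆E ∷ ⊆⇒∩≡ (∈⇒⁅⁆⊆ e∈X) ∷ []
    ... | no e∉X = inj₁ (begin
      r (X ∩ (E ─ ⁅ e ⁆)) + ∣ X ─ (E ─ ⁅ e ⁆) ∣
        ≡⟨ cong₂ (λ Y Z → r Y + ∣ Z ∣)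
             (solve (v₀ ∩ₑ v₂ ≐ v₀ ∷ v₁ ∩ₑ v₀ ≐ ∅ ∷ []) (v₀ ∩ₑ (v₂ ─ₑ v₁) ≐ v₀) _ ρ hyps)
             (solve (v₀ ∩ₑ v₂ ≐ v₀ ∷ v₁ ∩ₑ v₀ ≐ ∅ ∷ []) (v₀ ─ₑ (v₂ ─ₑ v₁) ≐ ∅) _ ρ hyps) ⟩
      r X + ∣ ⊥ {n = n} ∣  ≡⟨ cong (r X +_) (∣⊥∣≡0 n) ⟩
      r X + 0              ≡⟨ +-identityʳ (r X) ⟩
      r X                  ∎)
      where
      ρ : Vec (Subset n) 3
      ρ = X ∷ ⁅ e ⁆ ∷ E ∷ []
      hyps : All (ρ ⊨_) (v₀ ∩ₑ v₂ ≐ v₀ ∷ v₁ ∩ₑ v₀ ≐ ∅ ∷ [])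
      hyps = ⊆⇒∩≡ X⊆E ∷ ∉⇒⁅⁆∩≡⊥ e∉X ∷ []

  rankGain⇒coloop : ∀ {Y e} → Y ⊆ E → r Y + ∣ E ─ Y ∣ ≤ r E → e ∈ E ─ Y → r (E ─ ⁅ e ⁆) < r E
  rankGain⇒coloop {Y} {e} Y⊆E gain e∈E─Y = begin-strict
    r (E ─ ⁅ e ⁆)
      ≤⟨ rank-mono _ _ (∪-lub Y⊆E rest⊆E) (∩≡⇒⊆
           (solve [] ((v₀ ─ₑ v₂) ∩ₑ (v₁ ∪ₑ ((v₀ ─ₑ v₁) ─ₑ v₂)) ≐ v₀ ─ₑ v₂) _ (E ∷ Y ∷ ⁅ e ⁆ ∷ []) [])) ⟩
    r (Y ∪ ((E ─ Y) ─ ⁅ e ⁆))        ≤⟨ r[X∪Y]≤r[X]+∣Y∣ Y⊆E rest⊆E ⟩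
    r Y + ∣ (E ─ Y) ─ ⁅ e ⁆ ∣        <⟨ +-monoʳ-< (r Y) (n<1+n _) ⟩
    r Y + suc ∣ (E ─ Y) ─ ⁅ e ⁆ ∣    ≡⟨ cong (r Y +_) (x∈p⇒∣p∣≡1+∣p─⁅x⁆∣ e∈E─Y) ⟨
    r Y + ∣ E ─ Y ∣                  ≤⟨ gain ⟩
    r E                              ∎
    where
    rest⊆E : (E ─ Y) ─ ⁅ e ⁆ ⊆ E
    rest⊆E = ⊆-trans (p─q⊆p (E ─ Y) ⁅ e ⁆) (p─q⊆p E Y)

  trace-mono : ∀ {X Y} → X ⊆ Y → r (X ∩ E) ≤ r (Y ∩ E)
  trace-mono {X} {Y} X⊆Y = rank-mono (X ∩ E) (Y ∩ E) (p∩q⊆q Y E)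
    (λ x∈X∩E → let (x∈X , x∈E) = x∈p∩q⁻ X E x∈X∩E in x∈p∩q⁺ (X⊆Y x∈X , x∈E))

  trace-submod : ∀ X Y → r ((X ∪ Y) ∩ E) + r ((X ∩ Y) ∩ E) ≤ r (X ∩ E) + r (Y ∩ E)
  trace-submod X Y = subst₂ (λ U I → r U + r I ≤ r (X ∩ E) + r (Y ∩ E))
    (sym (∩-distribʳ-∪ E X Y))
    (solve [] ((v₀ ∩ₑ v₂) ∩ₑ (v₁ ∩ₑ v₂) ≐ (v₀ ∩ₑ v₁) ∩ₑ v₂) _ (X ∷ Y ∷ E ∷ []) [])
    (rank-submod (X ∩ E) (Y ∩ E) (p∩q⊆q X E) (p∩q⊆q Y E))

module DirectSum {n : ℕ} {A B E : Subset n} {rM rN rL : Subset n → ℕ}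
  (M : IsMatroid A rM) (N : IsMatroid B rN) (A∩B≡⊥ : A ∩ B ≡ ⊥) (A∪B≡E : A ∪ B ≡ E)
  (rL-split : ∀ X → rL X ≡ rM (X ∩ A) + rN (X ∩ B)) where

  open IsMatroid using (rank-bound; rank-mono)

  A⊆E : A ⊆ E
  A⊆E = subst (A ⊆_) A∪B≡E (p⊆p∪q B)

  rM[Y∩A]≤rL[Y] : ∀ Y → rM (Y ∩ A) ≤ rL Y
  rM[Y∩A]≤rL[Y] Y = subst (rM (Y ∩ A) ≤_) (sym (rL-split Y)) (m≤m+n _ _)

  rL≡rM : ∀ {X} → X ⊆ A → rL X ≡ rM X
  rL≡rM {X} X⊆A = begin-equality
    rL X                     ≡⟨ rL-split X ⟩
    rM (X ∩ A) + rN (X ∩ B)  ≡⟨ cong₂ (λ U V → rM U + rN V) (⊆⇒∩≡ X⊆A)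
                                 (solve (v₀ ∩ₑ v₁ ≐ v₀ ∷ v₁ ∩ₑ v₂ ≐ ∅ ∷ []) (v₀ ∩ₑ v₂ ≐ ∅) _
                                        (X ∷ A ∷ B ∷ []) (⊆⇒∩≡ X⊆A ∷ A∩B≡⊥ ∷ [])) ⟩
    rM X + rN ⊥              ≡⟨ cong (rM X +_) (r⊥≡0 N) ⟩
    rM X + 0                 ≡⟨ +-identityʳ (rM X) ⟩
    rM X                     ∎

  isMatroid : IsMatroid E rL
  isMatroid = record
    { rank-bound  = λ X X⊆E → begin
        rL X                       ≡⟨ rL-split X ⟩
        rM (X ∩ A) + rN (X ∩ B)    ≤⟨ +-mono-≤ (rank-bound M (X ∩ A) (p∩q⊆q X A)) (rank-bound N (X ∩ B) (p∩q⊆q X B)) ⟩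
        ∣ X ∩ A ∣ + ∣ X ∩ B ∣      ≡⟨ cong (λ Z → ∣ X ∩ A ∣ + ∣ Z ∣)
                                        (solve (v₀ ∩ₑ v₃ ≐ v₀ ∷ v₁ ∪ₑ v₂ ≐ v₃ ∷ v₁ ∩ₑ v₂ ≐ ∅ ∷ []) (v₀ ∩ₑ v₂ ≐ v₀ ─ₑ v₁) _
                                               (X ∷ A ∷ B ∷ E ∷ []) (⊆⇒∩≡ X⊆E ∷ A∪B≡E ∷ A∩B≡⊥ ∷ [])) ⟩
        ∣ X ∩ A ∣ + ∣ X ─ A ∣      ≡⟨ ∣p∣≡∣p∩q∣+∣p─q∣ X A ⟨
        ∣ X ∣                      ∎
    ; rank-mono   = λ X Y _ X⊆Y → begin
        rL X                       ≡⟨ rL-split X ⟩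
        rM (X ∩ A) + rN (X ∩ B)    ≤⟨ +-mono-≤ (trace-mono M X⊆Y) (trace-mono N X⊆Y) ⟩
        rM (Y ∩ A) + rN (Y ∩ B)    ≡⟨ rL-split Y ⟨
        rL Y                       ∎
    ; rank-submod = λ X Y _ _ → begin
        rL (X ∪ Y) + rL (X ∩ Y)
          ≡⟨ cong₂ _+_ (rL-split (X ∪ Y)) (rL-split (X ∩ Y)) ⟩
        (rM ((X ∪ Y) ∩ A) + rN ((X ∪ Y) ∩ B)) + (rM ((X ∩ Y) ∩ A) + rN ((X ∩ Y) ∩ B))
          ≡⟨ interchange (rM ((X ∪ Y) ∩ A)) (rN ((X ∪ Y) ∩ B)) (rM ((X ∩ Y) ∩ A)) (rN ((X ∩ Y) ∩ B)) ⟩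
        (rM ((X ∪ Y) ∩ A) + rM ((X ∩ Y) ∩ A)) + (rN ((X ∪ Y) ∩ B) + rN ((X ∩ Y) ∩ B))
          ≤⟨ +-mono-≤ (trace-submod M X Y) (trace-submod N X Y) ⟩
        (rM (X ∩ A) + rM (Y ∩ A)) + (rN (X ∩ B) + rN (Y ∩ B))
          ≡⟨ interchange (rM (X ∩ A)) (rM (Y ∩ A)) (rN (X ∩ B)) (rN (Y ∩ B)) ⟩
        (rM (X ∩ A) + rN (X ∩ B)) + (rM (Y ∩ A) + rN (Y ∩ B))
          ≡⟨ cong₂ _+_ (rL-split X) (rL-split Y) ⟨
        rL X + rL Y
          ∎
    }

  reducibleˡ : Reducible A rM → Reducible E rL
  reducibleˡ (C , D , sep@(C∪D≡A , _) , (p , p∈C─D) , (q , q∈D─C)) =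
    C ∪ B , D ∪ B ,
    tight⇒freeSeparator isMatroid (solve (v₀ ∪ₑ v₁ ≐ v₂ ∷ v₂ ∪ₑ v₃ ≐ v₄ ∷ []) ((v₀ ∪ₑ v₃) ∪ₑ (v₁ ∪ₑ v₃) ≐ v₄) _
                                         (C ∷ D ∷ A ∷ B ∷ E ∷ []) (C∪D≡A ∷ A∪B≡E ∷ [])) tight ,
    (p , subst (p ∈_) (sym (∪B─∪B D (subst (C ⊆_) C∪D≡A (p⊆p∪q D)))) p∈C─D) ,
    (q , subst (q ∈_) (sym (∪B─∪B C (subst (D ⊆_) C∪D≡A (q⊆p∪q C D)))) q∈D─C)
    where
    ∪B─∪B : ∀ {S} T → S ⊆ A → (S ∪ B) ─ (T ∪ B) ≡ S ─ T
    ∪B─∪B {S} T S⊆A = solve (v₀ ∩ₑ v₂ ≐ v₀ ∷ v₂ ∩ₑ v₃ ≐ ∅ ∷ []) ((v₀ ∪ₑ v₃) ─ₑ (v₁ ∪ₑ v₃) ≐ v₀ ─ₑ v₁) _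
                             (S ∷ T ∷ A ∷ B ∷ []) (⊆⇒∩≡ S⊆A ∷ A∩B≡⊥ ∷ [])
    tight : ∀ {X} → X ⊆ E → SpliceTight rL (C ∪ B) (D ∪ B) X
    tight {X} X⊆E = [ inj₁ ∘ lift₁ , inj₂ ∘ lift₂ ] (freeSeparator⇒tight M sep (p∩q⊆q X A))
      where
      ρ : Vec (Subset n) 6
      ρ = X ∷ C ∷ D ∷ A ∷ B ∷ E ∷ []
      lift₁ : rM ((X ∩ A) ∩ C) + ∣ (X ∩ A) ─ C ∣ ≤ rM (X ∩ A) → rL (X ∩ (C ∪ B)) + ∣ X ─ (C ∪ B) ∣ ≤ rL X
      lift₁ h = begin
        rL (X ∩ (C ∪ B)) + ∣ X ─ (C ∪ B) ∣
          ≡⟨ cong₂ _+_ (rL-split _)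
               (cong ∣_∣ (solve (v₀ ∩ₑ v₅ ≐ v₀ ∷ v₃ ∪ₑ v₄ ≐ v₅ ∷ v₃ ∩ₑ v₄ ≐ ∅ ∷ []) (v₀ ─ₑ (v₁ ∪ₑ v₄) ≐ (v₀ ∩ₑ v₃) ─ₑ v₁) _
                                ρ (⊆⇒∩≡ X⊆E ∷ A∪B≡E ∷ A∩B≡⊥ ∷ []))) ⟩
        rM ((X ∩ (C ∪ B)) ∩ A) + rN ((X ∩ (C ∪ B)) ∩ B) + ∣ (X ∩ A) ─ C ∣
          ≡⟨ cong₂ (λ U V → rM U + rN V + ∣ (X ∩ A) ─ C ∣)
               (solve (v₁ ∪ₑ v₂ ≐ v₃ ∷ v₃ ∩ₑ v₄ ≐ ∅ ∷ []) ((v₀ ∩ₑ (v₁ ∪ₑ v₄)) ∩ₑ v₃ ≐ (v₀ ∩ₑ v₃) ∩ₑ v₁) _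
                      ρ (C∪D≡A ∷ A∩B≡⊥ ∷ []))
               (solve [] ((v₀ ∩ₑ (v₁ ∪ₑ v₄)) ∩ₑ v₄ ≐ v₀ ∩ₑ v₄) _ ρ []) ⟩
        rM ((X ∩ A) ∩ C) + rN (X ∩ B) + ∣ (X ∩ A) ─ C ∣
          ≡⟨ xy∙z≈xz∙y (rM ((X ∩ A) ∩ C)) (rN (X ∩ B)) ∣ (X ∩ A) ─ C ∣ ⟩
        rM ((X ∩ A) ∩ C) + ∣ (X ∩ A) ─ C ∣ + rN (X ∩ B)  ≤⟨ +-monoˡ-≤ (rN (X ∩ B)) h ⟩
        rM (X ∩ A) + rN (X ∩ B)                           ≡⟨ rL-split X ⟨
        rL X                                              ∎
      lift₂ : rM (((X ∩ A) ∩ D) ∪ (C ─ D)) ≤ rM (X ∩ A) → rL ((X ∩ (D ∪ B)) ∪ ((C ∪ B) ─ (D ∪ B))) ≤ rL X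
      lift₂ h = begin
        rL ((X ∩ (D ∪ B)) ∪ ((C ∪ B) ─ (D ∪ B)))
          ≡⟨ rL-split _ ⟩
        rM (((X ∩ (D ∪ B)) ∪ ((C ∪ B) ─ (D ∪ B))) ∩ A) + rN (((X ∩ (D ∪ B)) ∪ ((C ∪ B) ─ (D ∪ B))) ∩ B)
          ≡⟨ cong₂ (λ U V → rM U + rN V)
               (solve (v₁ ∪ₑ v₂ ≐ v₃ ∷ v₃ ∩ₑ v₄ ≐ ∅ ∷ [])
                      (((v₀ ∩ₑ (v₂ ∪ₑ v₄)) ∪ₑ ((v₁ ∪ₑ v₄) ─ₑ (v₂ ∪ₑ v₄))) ∩ₑ v₃ ≐ ((v₀ ∩ₑ v₃) ∩ₑ v₂) ∪ₑ (v₁ ─ₑ v₂)) _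
                      ρ (C∪D≡A ∷ A∩B≡⊥ ∷ []))
               (solve [] (((v₀ ∩ₑ (v₂ ∪ₑ v₄)) ∪ₑ ((v₁ ∪ₑ v₄) ─ₑ (v₂ ∪ₑ v₄))) ∩ₑ v₄ ≐ v₀ ∩ₑ v₄) _ ρ []) ⟩
        rM (((X ∩ A) ∩ D) ∪ (C ─ D)) + rN (X ∩ B)  ≤⟨ +-monoˡ-≤ (rN (X ∩ B)) h ⟩
        rM (X ∩ A) + rN (X ∩ B)                    ≡⟨ rL-split X ⟨
        rL X                                       ∎

  reducible-restrict : ∀ {C D p q} → IsFreeSeparator E rL C D →
    p ∈ C ─ D → p ∈ A → q ∈ D ─ C → q ∈ A → Reducible A rM
  reducible-restrict {C} {D} {p} {q} sep@(C∪D≡E , _) p∈C─D p∈A q∈D─C q∈A =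
    C ∩ A , D ∩ A ,
    tight⇒freeSeparator M (solve (v₀ ∪ₑ v₁ ≐ v₄ ∷ v₂ ∪ₑ v₃ ≐ v₄ ∷ []) ((v₀ ∩ₑ v₂) ∪ₑ (v₁ ∩ₑ v₂) ≐ v₂) _
                                 (C ∷ D ∷ A ∷ B ∷ E ∷ []) (C∪D≡E ∷ A∪B≡E ∷ [])) tight ,
    (p , x∈p─q⇒x∈p∩s─q∩s p∈C─D p∈A) ,
    (q , x∈p─q⇒x∈p∩s─q∩s q∈D─C q∈A)
    where
    tight : ∀ {X} → X ⊆ A → SpliceTight rM (C ∩ A) (D ∩ A) X
    tight {X} X⊆A = [ inj₁ ∘ restrict₁ , inj₂ ∘ restrict₂ ] (freeSeparator⇒tight isMatroid sep (⊆-trans X⊆A A⊆E))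
      where
      restrict₁ : rL (X ∩ C) + ∣ X ─ C ∣ ≤ rL X → rM (X ∩ (C ∩ A)) + ∣ X ─ (C ∩ A) ∣ ≤ rM X
      restrict₁ h = begin
        rM (X ∩ (C ∩ A)) + ∣ X ─ (C ∩ A) ∣
          ≡⟨ cong₂ (λ U V → rM U + ∣ V ∣) (sym (∩-assoc X C A))
               (solve (v₀ ∩ₑ v₂ ≐ v₀ ∷ []) (v₀ ─ₑ (v₁ ∩ₑ v₂) ≐ v₀ ─ₑ v₁) _ (X ∷ C ∷ A ∷ []) (⊆⇒∩≡ X⊆A ∷ [])) ⟩
        rM ((X ∩ C) ∩ A) + ∣ X ─ C ∣  ≤⟨ +-monoˡ-≤ ∣ X ─ C ∣ (rM[Y∩A]≤rL[Y] (X ∩ C)) ⟩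
        rL (X ∩ C) + ∣ X ─ C ∣        ≤⟨ h ⟩
        rL X                          ≡⟨ rL≡rM X⊆A ⟩
        rM X                          ∎
      restrict₂ : rL ((X ∩ D) ∪ (C ─ D)) ≤ rL X → rM ((X ∩ (D ∩ A)) ∪ ((C ∩ A) ─ (D ∩ A))) ≤ rM X
      restrict₂ h = begin
        rM ((X ∩ (D ∩ A)) ∪ ((C ∩ A) ─ (D ∩ A)))
          ≡⟨ cong rM (solve [] ((v₀ ∩ₑ (v₂ ∩ₑ v₃)) ∪ₑ ((v₁ ∩ₑ v₃) ─ₑ (v₂ ∩ₑ v₃)) ≐ ((v₀ ∩ₑ v₂) ∪ₑ (v₁ ─ₑ v₂)) ∩ₑ v₃) _
                              (X ∷ C ∷ D ∷ A ∷ []) []) ⟩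
        rM (((X ∩ D) ∪ (C ─ D)) ∩ A)  ≤⟨ rM[Y∩A]≤rL[Y] _ ⟩
        rL ((X ∩ D) ∪ (C ─ D))        ≤⟨ h ⟩
        rL X                          ≡⟨ rL≡rM X⊆A ⟩
        rM X                          ∎

  reducible-across : ∀ {C D p q} → 2 ≤ ∣ A ∣ → 2 ≤ ∣ B ∣ → IsFreeSeparator E rL C D →
    p ∈ C ─ D → p ∈ B → q ∈ D ─ C → q ∈ A → Reducible A rM ⊎ Reducible B rN
  reducible-across {C} {D} {p} {q} 2≤∣A∣ 2≤∣B∣ sep@(C∪D≡E , _) p∈C─D p∈B q∈D─C q∈A =
    [ inj₁ ∘ qColoop , inj₂ ∘ pLoop ] (freeSeparator⇒tight isMatroid sep A⊆E)
    where
    qColoop : rL (A ∩ C) + ∣ A ─ C ∣ ≤ rL A → Reducible A rM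
    qColoop h = coloop⇒reducible M 2≤∣A∣ q∈A (rankGain⇒coloop M (p∩q⊆p A C) gain q∉A∩C)
      where
      q∉A∩C : q ∈ A ─ (A ∩ C)
      q∉A∩C = x∈p∧x∉q⇒x∈p─q q∈A (λ q∈A∩C → x∈p─q⇒x∉q q∈D─C (p∩q⊆q A C q∈A∩C))
      gain : rM (A ∩ C) + ∣ A ─ (A ∩ C) ∣ ≤ rM A
      gain = begin
        rM (A ∩ C) + ∣ A ─ (A ∩ C) ∣
          ≡⟨ cong₂ (λ U V → U + ∣ V ∣) (sym (rL≡rM (p∩q⊆p A C))) (solve [] (v₀ ─ₑ (v₀ ∩ₑ v₁) ≐ v₀ ─ₑ v₁) _ (A ∷ C ∷ []) []) ⟩
        rL (A ∩ C) + ∣ A ─ C ∣  ≤⟨ h ⟩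
        rL A                    ≡⟨ rL≡rM ⊆-refl ⟩
        rM A                    ∎
    pLoop : rL ((A ∩ D) ∪ (C ─ D)) ≤ rL A → Reducible B rN
    pLoop h = loop⇒reducible N 2≤∣B∣ p∈B
      (n≤0⇒n≡0 (≤-trans (rank-mono N ⁅ p ⁆ (Y ∩ B) (p∩q⊆q Y B) (∈⇒⁅⁆⊆ p∈Y∩B)) rN[Y∩B]≤0))
      where
      Y : Subset n
      Y = (A ∩ D) ∪ (C ─ D)
      p∈Y∩B : p ∈ Y ∩ B
      p∈Y∩B = x∈p∩q⁺ (q⊆p∪q (A ∩ D) (C ─ D) p∈C─D , p∈B)
      rN[Y∩B]≤0 : rN (Y ∩ B) ≤ 0
      rN[Y∩B]≤0 = +-cancelˡ-≤ (rM A) (rN (Y ∩ B)) 0 (begin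
        rM A + rN (Y ∩ B)
          ≡⟨ cong (λ U → rM U + rN (Y ∩ B))
               (solve (v₁ ∪ₑ v₂ ≐ v₄ ∷ v₀ ∪ₑ v₃ ≐ v₄ ∷ []) (((v₀ ∩ₑ v₂) ∪ₑ (v₁ ─ₑ v₂)) ∩ₑ v₀ ≐ v₀) _
                      (A ∷ C ∷ D ∷ B ∷ E ∷ []) (C∪D≡E ∷ A∪B≡E ∷ [])) ⟨
        rM (Y ∩ A) + rN (Y ∩ B)  ≡⟨ rL-split Y ⟨
        rL Y                     ≤⟨ h ⟩
        rL A                     ≡⟨ rL≡rM ⊆-refl ⟩
        rM A                     ≡⟨ +-identityʳ (rM A) ⟨
        rM A + 0                 ∎)

module _ {n : ℕ} {A B : Subset n} {rM rN : Subset n → ℕ}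
  (M : IsMatroid A rM) (N : IsMatroid B rN) (A∩B≡⊥ : A ∩ B ≡ ⊥) where

  private
    module AB = DirectSum M N A∩B≡⊥ refl (λ _ → refl)
    module BA = DirectSum N M (trans (∩-comm B A) A∩B≡⊥) (∪-comm B A) (λ X → +-comm (rM (X ∩ A)) (rN (X ∩ B)))

    side : ∀ {C D x} → C ∪ D ≡ A ∪ B → x ∈ C ∪ D → x ∈ A ⊎ x ∈ B
    side {x = x} C∪D≡A∪B = x∈p∪q⁻ A B ∘ subst (x ∈_) C∪D≡A∪B

  ⊕-reducibleˡ : Reducible A rM → Reducible (A ∪ B) (directSumRank A rM B rN)
  ⊕-reducibleˡ = AB.reducibleˡ

  ⊕-reducibleʳ : Reducible B rN → Reducible (A ∪ B) (directSumRank A rM B rN)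
  ⊕-reducibleʳ = BA.reducibleˡ

  ⊕-reducible⇒ : 2 ≤ ∣ A ∣ → 2 ≤ ∣ B ∣ → Reducible (A ∪ B) (directSumRank A rM B rN) → Reducible A rM ⊎ Reducible B rN
  ⊕-reducible⇒ 2≤∣A∣ 2≤∣B∣ (C , D , sep@(C∪D≡A∪B , _) , (p , p∈C─D) , (q , q∈D─C))
    with side C∪D≡A∪B (p⊆p∪q D (p─q⊆p C D p∈C─D)) | side C∪D≡A∪B (q⊆p∪q C D (p─q⊆p D C q∈D─C))
  ... | inj₁ p∈A | inj₁ q∈A = inj₁ (AB.reducible-restrict sep p∈C─D p∈A q∈D─C q∈A)
  ... | inj₂ p∈B | inj₂ q∈B = inj₂ (BA.reducible-restrict sep p∈C─D p∈B q∈D─C q∈B)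
  ... | inj₂ p∈B | inj₁ q∈A = AB.reducible-across 2≤∣A∣ 2≤∣B∣ sep p∈C─D p∈B q∈D─C q∈A
  ... | inj₁ p∈A | inj₂ q∈B = swap (BA.reducible-across 2≤∣B∣ 2≤∣A∣ sep p∈C─D p∈A q∈D─C q∈B)

proposition5p2 : ∀ {n : ℕ} (A B : Subset n) (rM rN : Subset n → ℕ) →
    IsMatroid A rM → IsMatroid B rN → A ∩ B ≡ ⊥ → 2 ≤ ∣ A ∣ → 2 ≤ ∣ B ∣ →
    Irreducible (A ∪ B) (directSumRank A rM B rN) ⇔ (Irreducible A rM × Irreducible B rN)
proposition5p2 A B rM rN M N A∩B≡⊥ 2≤∣A∣ 2≤∣B∣ = mk⇔
  (λ irreducible → irreducible ∘ ⊕-reducibleˡ M N A∩B≡⊥ , irreducible ∘ ⊕-reducibleʳ M N A∩B≡⊥)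
  (λ (irreducibleM , irreducibleN) → [ irreducibleM , irreducibleN ] ∘ ⊕-reducible⇒ M N A∩B≡⊥ 2≤∣A∣ 2≤∣B∣)
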